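{- Let $(a_i)_{i\geq 1}$ be a sequence of positive integers with property $\mathcal{L}$, and let $(b_i)_{i\geq1}$ be its b-sequence. Then the set of primes dividing some term of $(a_i)$ equals the set of primes dividing some term of $(b_i)$, and for each such prime $p$ the rank of $p$ in $(a_i)$ equals the rank of $p$ in $(b_i)$.
   Context: For a prime $p$ and a nonzero integer $a$, $\nu_p(a)$ denotes the exponent of the largest power of $p$ dividing $a$. A sequence $(a_i)_{i\geq1}$ has property $\mathcal{L}$ if for every positive integer $k$, every odd prime $p$ dividing $a_k$, and every positive integer $n$, one has $\nu_p(a_{kn})=\nu_p(a_k)+\nu_p(n)$. The b-sequence of $(a_i)$ is defined by $b_1=a_1$ and $b_n=\dfrac{\operatorname{lcm}(a_1,\dots,a_n)}{\operatorname{lcm}(a_1,\dots,a_{n-1})}$ for $n\geq 2$. For a sequence of positive integers $(c_i)$ and a prime $p$ dividing some term, the rank of $p$ in $(c_i)$ is the smallest index $k$ with $p\mid c_k$. -}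

module Defs where

open import Data.Nat using (ℕ; zero; suc; _+_; _*_; _^_; _≤_; _<_)
open import Data.Nat.Divisibility using (_∣_)
open import Data.Nat.LCM using (lcm)
open import Data.Nat.Primality using (Prime)
open import Data.Product using (_×_; ∃-syntax)
open import Relation.Nullary using (¬_)
open import Relation.Binary.PropositionalEquality using (_≡_)

-- Sequences (a_i)_{i ≥ 1} are modelled as functions ℕ → ℕ; the value at 0 is ignored.

Val : ℕ → ℕ → ℕ → Set
Val p x e = (p ^ e ∣ x) × ¬ (p ^ suc e ∣ x)

Positive : (ℕ → ℕ) → Set
Positive a = ∀ i → 1 ≤ i → 1 ≤ a i

PropertyL : (ℕ → ℕ) → Set
PropertyL a = ∀ k p n → 1 ≤ k → Prime p → ¬ (p ≡ 2) → p ∣ a k → 1 ≤ n →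
  ∀ e f → Val p (a k) e → Val p n f → Val p (a (k * n)) (e + f)

lcmUpTo : (ℕ → ℕ) → ℕ → ℕ
lcmUpTo a zero = 1
lcmUpTo a (suc n) = lcm (lcmUpTo a n) (a (suc n))

-- b is the b-sequence of a: b_1 = a_1 and b_n = L n / L (n-1) for n ≥ 2
-- (stated as b_n * L(n-1) = L n; L(n-1) > 0 for positive a, so b_n is determined)
IsBSeq : (ℕ → ℕ) → (ℕ → ℕ) → Set
IsBSeq a b = (b 1 ≡ a 1) × (∀ n → 1 ≤ n → b (suc n) * lcmUpTo a n ≡ lcmUpTo a (suc n))

DividesSomeTerm : ℕ → (ℕ → ℕ) → Set
DividesSomeTerm p c = ∃[ k ] (1 ≤ k × p ∣ c k)

IsRank : (ℕ → ℕ) → ℕ → ℕ → Set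
IsRank c p k = 1 ≤ k × p ∣ c k × (∀ j → 1 ≤ j → j < k → ¬ (p ∣ c j))

module Submission where

-- Write L n = lcm(a_1, …, a_n).  For a prime p and a
-- sequence c, say that p "divides c up to j" if p ∣ c_i for some 1 ≤ i ≤ j.
-- Both a and b are controlled by the same chain L in the following sense
-- (an "envelope"): L 0 = 1, L n ∣ L (n+1), c_(n+1) ∣ L (n+1) and
-- L (n+1) ∣ L n · c_(n+1).  For any envelope M of c and any prime p,
-- p ∣ M j holds exactly when p divides c up to j (Euclid's lemma drives the
-- induction).  Hence a and b have the same primes dividing them up to every
-- index j.  Two sequences with this property have the same primes dividing
-- some term and the same rank for each such prime, which is the theorem.

open import Defs
open import Data.Nat using (ℕ; zero; suc; _≤_; _<_; _*_; z≤n; s≤s; _≤′_; ≤′-refl; ≤′-step)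
open import Data.Nat.Properties
  using (≤-refl; ≤-antisym; ≤-<-trans; <-irrefl; ≮⇒≥; m≤n⇒m≤1+n; ≤⇒≤′; *-comm)
open import Data.Nat.Divisibility using (_∣_; ∣-refl; ∣-reflexive; ∣-trans; ∣1⇒≡1; m∣m*n; n∣m*n)
open import Data.Nat.LCM using (lcm; m∣lcm[m,n]; n∣lcm[m,n]; lcm-least)
open import Data.Nat.Primality using (Prime; euclidsLemma; prime⇒nonTrivial)
open import Data.Nat.Base using (nonTrivial⇒n>1)
open import Data.Product using (_×_; _,_; ∃-syntax)
open import Data.Sum using (inj₁; inj₂)
open import Data.Empty using (⊥-elim)
open import Relation.Nullary using (¬_)
open import Relation.Binary.PropositionalEquality using (_≡_; refl; sym; trans; subst)
open import Function.Bundles using (_⇔_; mk⇔; Equivalence)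
open import Function.Properties.Equivalence using () renaming (sym to ⇔-sym; trans to ⇔-trans)

prime∤1 : ∀ {p} → Prime p → ¬ (p ∣ 1)
prime∤1 pp p∣1 with ∣1⇒≡1 p∣1
... | refl = <-irrefl refl (nonTrivial⇒n>1 1 {{prime⇒nonTrivial pp}})

DividesUpTo : ℕ → (ℕ → ℕ) → ℕ → Set
DividesUpTo p c j = ∃[ i ] (1 ≤ i × i ≤ j × p ∣ c i)

record Envelope (M c : ℕ → ℕ) : Set where
  field
    base  : M 0 ≡ 1
    chain : ∀ n → M n ∣ M (suc n)
    term  : ∀ n → c (suc n) ∣ M (suc n)
    step  : ∀ n → M (suc n) ∣ M n * c (suc n)

module _ {M c : ℕ → ℕ} (env : Envelope M c) where
  open Envelope env

  envelope-mono : ∀ {i j} → i ≤′ j → M i ∣ M j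
  envelope-mono ≤′-refl         = ∣-refl
  envelope-mono (≤′-step i≤′j) = ∣-trans (envelope-mono i≤′j) (chain _)

  term∣envelope : ∀ {i j} → 1 ≤ i → i ≤ j → c i ∣ M j
  term∣envelope {suc i} _ i≤j = ∣-trans (term i) (envelope-mono (≤⇒≤′ i≤j))

  envelope-primes : ∀ {p} j → Prime p → p ∣ M j ⇔ DividesUpTo p c j
  envelope-primes {p} j pp = mk⇔ (found j) λ (i , 1≤i , i≤j , p∣cᵢ) →
    ∣-trans p∣cᵢ (term∣envelope 1≤i i≤j)
    where
    found : ∀ j → p ∣ M j → DividesUpTo p c j
    found zero    p∣M₀ = ⊥-elim (prime∤1 pp (subst (p ∣_) base p∣M₀))
    found (suc n) p∣M with euclidsLemma (M n) (c (suc n)) pp (∣-trans p∣M (step n))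
    ... | inj₂ p∣c = suc n , s≤s z≤n , ≤-refl , p∣c
    ... | inj₁ p∣Mₙ with found n p∣Mₙ
    ...   | i , 1≤i , i≤n , p∣cᵢ = i , 1≤i , m≤n⇒m≤1+n i≤n , p∣cᵢ

shared-envelope : ∀ {M c d p} → Envelope M c → Envelope M d → Prime p →
  ∀ j → DividesUpTo p c j ⇔ DividesUpTo p d j
shared-envelope envc envd pp j =
  ⇔-trans (⇔-sym (envelope-primes envc j pp)) (envelope-primes envd j pp)

lcm-envelope : (a : ℕ → ℕ) → Envelope (lcmUpTo a) a
lcm-envelope a = record
  { base  = refl
  ; chain = λ n → m∣lcm[m,n] (lcmUpTo a n) (a (suc n))
  ; term  = λ n → n∣lcm[m,n] (lcmUpTo a n) (a (suc n))
  ; step  = λ n → lcm-least {lcmUpTo a n} (m∣m*n (a (suc n))) (n∣m*n (lcmUpTo a n))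
  }

-- They also form an envelope of the b-sequence, since b_(n+1) · L n = L (n+1).
b-envelope : (a b : ℕ → ℕ) → IsBSeq a b → Envelope (lcmUpTo a) b
b-envelope a b (b₁≡a₁ , bStep) = record
  { base  = refl
  ; chain = chain
  ; term  = term
  ; step  = step
  }
  where
  open Envelope (lcm-envelope a) using (chain)
  L = lcmUpTo a

  term : ∀ n → b (suc n) ∣ L (suc n)
  term zero    = subst (_∣ L 1) (sym b₁≡a₁) (Envelope.term (lcm-envelope a) 0)
  term (suc n) = subst (b (suc (suc n)) ∣_) (bStep (suc n) (s≤s z≤n)) (m∣m*n (L (suc n)))

  step : ∀ n → L (suc n) ∣ L n * b (suc n)
  step zero    = subst (λ x → L 1 ∣ 1 * x) (sym b₁≡a₁) (Envelope.step (lcm-envelope a) 0)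
  step (suc n) = ∣-reflexive (trans (sym (bStep (suc n) (s≤s z≤n))) (*-comm (b (suc (suc n))) (L (suc n))))

somewhere-transfer : ∀ {c d p} → (∀ j → DividesUpTo p c j → DividesUpTo p d j) →
  DividesSomeTerm p c → DividesSomeTerm p d
somewhere-transfer c⇒d (k , 1≤k , p∣cₖ) with c⇒d k (k , 1≤k , ≤-refl , p∣cₖ)
... | i , 1≤i , _ , p∣dᵢ = i , 1≤i , p∣dᵢ

below-rank : ∀ {c p k} → IsRank c p k → ∀ j → j < k → ¬ DividesUpTo p c j
below-rank (_ , _ , minimal) j j<k (i , 1≤i , i≤j , p∣cᵢ) = minimal i 1≤i (≤-<-trans i≤j j<k) p∣cᵢ

rank-transfer : ∀ {c d p k} → (∀ j → DividesUpTo p c j ⇔ DividesUpTo p d j) →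
  IsRank c p k → IsRank d p k
rank-transfer {c} {d} {p} {k} same rank@(1≤k , p∣cₖ , _)
  with Equivalence.to (same k) (k , 1≤k , ≤-refl , p∣cₖ)
... | i , 1≤i , i≤k , p∣dᵢ = 1≤k , subst (λ x → p ∣ d x) i≡k p∣dᵢ , minimal
  where
  earlier : ∀ j → j < k → ¬ DividesUpTo p d j
  earlier j j<k h = below-rank rank j j<k (Equivalence.from (same j) h)

  i≡k : i ≡ k
  i≡k = ≤-antisym i≤k (≮⇒≥ λ i<k → earlier i i<k (i , 1≤i , ≤-refl , p∣dᵢ))

  minimal : ∀ j → 1 ≤ j → j < k → ¬ (p ∣ d j)
  minimal j 1≤j j<k p∣dⱼ = earlier j j<k (j , 1≤j , ≤-refl , p∣dⱼ)

mainTheorem3 : (a b : ℕ → ℕ) → Positive a → PropertyL a → IsBSeq a b →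
    (∀ p → Prime p → (DividesSomeTerm p a ⇔ DividesSomeTerm p b))
    × (∀ p k → Prime p → DividesSomeTerm p a → (IsRank a p k ⇔ IsRank b p k))
mainTheorem3 a b _ _ isB = same-primes , same-rank
  where
  same : ∀ {p} → Prime p → ∀ j → DividesUpTo p a j ⇔ DividesUpTo p b j
  same = shared-envelope (lcm-envelope a) (b-envelope a b isB)

  same-primes : ∀ p → Prime p → DividesSomeTerm p a ⇔ DividesSomeTerm p b
  same-primes p pp = mk⇔ (somewhere-transfer (λ j → Equivalence.to (same pp j)))
                         (somewhere-transfer (λ j → Equivalence.from (same pp j)))

  same-rank : ∀ p k → Prime p → DividesSomeTerm p a → IsRank a p k ⇔ IsRank b p k
  same-rank p k pp _ = mk⇔ (rank-transfer (same pp))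
                           (rank-transfer (λ j → ⇔-sym (same pp j)))
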